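{- Let $\mathcal{P}$ be a hereditary property of ordered graphs, and let $k,M\geqslant0$ be integers. Suppose that for every $G\in\mathcal{P}$ the homogeneous block sequence $t_1\geqslant t_2\geqslant\cdots$ of $G$ satisfies $\sum_{i=k+2}^\infty t_i\leqslant M$. Then $|\mathcal{P}_n|=O(n^k)$ as $n\to\infty$.
   Context: An ordered graph of order $n$ is a graph on vertex set $[n]$ with the natural order; a hereditary property of ordered graphs is a class closed under order-preserving isomorphism and induced ordered subgraphs; $\mathcal{P}_n=\{G\in\mathcal{P}:V(G)=[n]\}$. A homogeneous block of $G$ is a maximal set $B$ of consecutive vertices such that $\Gamma(x)\setminus\{y\}=\Gamma(y)\setminus\{x\}$ for all $x,y\in B$ ($\Gamma$ denoting neighbourhood); the homogeneous blocks partition $V(G)$ uniquely. The homogeneous block sequence of $G$ is $t_1\geqslant t_2\geqslant\cdots$, the sizes of the homogeneous blocks in non-increasing order, followed by zeros. -}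

module Defs where

open import Data.Bool using (Bool; true; false)
open import Data.Nat using (ℕ; zero; suc; _+_; _*_; _∸_; _^_; _≤_; _<_; _≥_)
open import Data.Fin using (Fin; toℕ)
open import Data.Product using (Σ; _×_; _,_; ∃-syntax)
open import Data.List using (List; map; drop; length)
open import Data.List.Membership.Propositional using (_∈_)
open import Data.List.Relation.Unary.Unique.Propositional using (Unique)
open import Data.List.Relation.Unary.Linked using (Linked)
open import Data.List.Relation.Unary.AllPairs using (AllPairs)
open import Data.List.Relation.Binary.Permutation.Propositional using (_↭_)
open import Relation.Binary.PropositionalEquality using (_≡_; _≢_)
open import Relation.Nullary using (¬_)
open import Function.Bundles using (_⇔_)

-- An ordered graph of order n: vertex set Fin n = [n] (natural order),
-- simple, undirected (symmetric, loopless adjacency).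
record Graph (n : ℕ) : Set where
  field
    adj    : Fin n → Fin n → Bool
    sym    : ∀ x y → adj x y ≡ adj y x
    irrefl : ∀ x → adj x x ≡ false
open Graph public

Edge : ∀ {n} → Graph n → Fin n → Fin n → Set
Edge G x y = adj G x y ≡ true

_≈G_ : ∀ {n} → Graph n → Graph n → Set
G ≈G H = ∀ x y → adj G x y ≡ adj H x y

induced : ∀ {m n} → Graph n → (f : Fin m → Fin n) → Graph m
induced G f = record
  { adj    = λ x y → adj G (f x) (f y)
  ; sym    = λ x y → sym G (f x) (f y)
  ; irrefl = λ x → irrefl G (f x)
  }

StrictlyIncreasing : ∀ {m n} → (Fin m → Fin n) → Set
StrictlyIncreasing f = ∀ x y → toℕ x < toℕ y → toℕ (f x) < toℕ (f y)

Property : Set₁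
Property = (n : ℕ) → Graph n → Set

-- Hereditary: closed under order-preserving isomorphism (on [n] the only
-- order-preserving bijection is the identity, so this is closure under
-- having the same edge set) and under induced ordered subgraphs.
record Hereditary (P : Property) : Set where
  field
    iso-closed     : ∀ {n} (G H : Graph n) → G ≈G H → P n G → P n H
    induced-closed : ∀ {m n} (G : Graph n) (f : Fin m → Fin n) →
                     StrictlyIncreasing f → P n G → P m (induced G f)

Twins : ∀ {n} → Graph n → Fin n → Fin n → Set
Twins G x y = ∀ z → ((Edge G x z × z ≢ y) ⇔ (Edge G y z × z ≢ x))

-- Consecutive vertex sets are intervals {i : a ≤ i < b}, encoded as (a , b).
InInterval : ∀ {n} → ℕ × ℕ → Fin n → Set
InInterval (a , b) i = a ≤ toℕ i × toℕ i < b

Homogeneous : ∀ {n} → Graph n → ℕ × ℕ → Set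
Homogeneous G I = ∀ x y → InInterval I x → InInterval I y → Twins G x y

IsHomBlock : ∀ {n} → Graph n → ℕ × ℕ → Set
IsHomBlock {n} G (a , b) =
  a < b × b ≤ n × Homogeneous G (a , b) ×
  (∀ a' b' → a' ≤ a → b ≤ b' → b' ≤ n → Homogeneous G (a' , b') →
     a' ≡ a × b' ≡ b)

size : ℕ × ℕ → ℕ
size (a , b) = b ∸ a

-- ts is the homogeneous block sequence of G (without the trailing zeros):
-- the sizes of all homogeneous blocks, listed in non-increasing order.
IsHomBlockSeq : ∀ {n} → Graph n → List ℕ → Set
IsHomBlockSeq G ts =
  Σ (List (ℕ × ℕ)) λ bs →
    Unique bs × (∀ I → (I ∈ bs) ⇔ IsHomBlock G I) ×
    (ts ↭ map size bs) × Linked _≥_ ts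

Distinct : ∀ {n} → List (Graph n) → Set
Distinct = AllPairs (λ G H → ¬ (G ≈G H))

module Submission where

-- Twinhood is transitive, so an interval is homogeneous iff all its pairs of consecutive vertices
-- are twins: the homogeneous blocks are the maximal such runs, found by one left-to-right scan, and
-- the adjacency of two distinct vertices depends only on the blocks containing them. A graph is
-- therefore determined by its block sizes and a block-by-block adjacency table. The hypothesis
-- allows at most k + 1 + M blocks, at most k + 1 of them of size > M; recording the sizes ≤ M, the
-- larger sizes except the last one (which is n minus the others) and the table leaves O(n^k)
-- possible records, and distinct graphs get distinct records.

open import Defs
open import Data.Nat using (ℕ; _*_; _^_; _≤_; suc)
open import Data.Product using (∃-syntax; _×_)
open import Data.List using (List; drop; length)
open import Data.Nat.ListAction using (sum)
open import Data.List.Relation.Unary.All using (All)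

open import Data.Bool using (Bool; true; false)
open import Data.Bool.Properties using (⇔→≡; not-¬) renaming (_≟_ to _≟ᴮ_)
open import Data.Fin using (toℕ; fromℕ<)
open import Data.Fin.Properties using (fromℕ<-toℕ; toℕ-fromℕ<; toℕ<n; toℕ-injective)
open import Data.List
  using ([]; _∷_; map; _++_; take; cartesianProductWith; cartesianProduct; applyUpTo; upTo)
open import Data.List.Properties
  using (length-map; length-++; length-removeAt′; length-applyUpTo; length-upTo)
open import Data.List.Membership.Propositional using (_∈_)
open import Data.List.Membership.Propositional.Properties using (∈-cartesianProductWith⁺; ∈-upTo⁺)
open import Data.List.Relation.Binary.Permutation.Propositional using (_↭_; ↭-sym)
open import Data.List.Relation.Binary.Permutation.Propositional.Properties
  using (map⁺; ↭-length; All-resp-↭)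
open import Data.List.Relation.Binary.Subset.Propositional using (_⊆_)
open import Data.List.Relation.Unary.All using ([]; _∷_)
import Data.List.Relation.Unary.All as All
import Data.List.Relation.Unary.All.Properties as All
open import Data.List.Relation.Unary.AllPairs using (AllPairs; []; _∷_)
open import Data.List.Relation.Unary.Any using (here; there; _─_)
open import Data.List.Relation.Unary.Unique.Propositional using (Unique)
open import Data.Nat using (zero; _+_; _∸_; _<_; z≤n; s≤s; s≤s⁻¹; _<?_; pred)
open import Data.Nat.ListAction.Properties using (sum-↭)
open import Data.Nat.Properties
open import Data.Nat.Solver using (module +-*-Solver)
open import Data.Product using (_,_; proj₁; proj₂)
open import Data.Sum using (_⊎_; inj₁; inj₂)
open import Function using (_∘_)
open import Function.Bundles using (_⇔_; mk⇔; Equivalence)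
open import Relation.Binary.PropositionalEquality hiding (sym; J)
import Relation.Binary.PropositionalEquality as ≡
import Relation.Binary.Properties.DecTotalOrder as DecTotalOrder
open import Data.List.Sort (DecTotalOrder.≥-decTotalOrder ≤-decTotalOrder) using (sort; sort-↭; sort-↗)
open import Relation.Nullary using (¬_; Dec; yes; no; contradiction)
open import Relation.Nullary.Decidable using (_→-dec_; ¬?)

private
  variable
    X Y Z : Set

length-cartesianProductWith : (f : X → Y → Z) → ∀ xs ys →
  length (cartesianProductWith f xs ys) ≡ length xs * length ys
length-cartesianProductWith f []       ys = refl
length-cartesianProductWith f (x ∷ xs) ys = begin
  length (map (f x) ys ++ cartesianProductWith f xs ys)  ≡⟨ length-++ (map (f x) ys) ⟩
  length (map (f x) ys) + length (cartesianProductWith f xs ys)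
    ≡⟨ cong₂ _+_ (length-map (f x) ys) (length-cartesianProductWith f xs ys) ⟩
  length ys + length xs * length ys                       ∎
  where open ≡-Reasoning

lookupOr : X → List X → ℕ → X
lookupOr d []       _       = d
lookupOr d (x ∷ xs) zero    = x
lookupOr d (x ∷ xs) (suc i) = lookupOr d xs i

lookupOr-applyUpTo : ∀ d (f : ℕ → X) {m i} → i < m → lookupOr d (applyUpTo f m) i ≡ f i
lookupOr-applyUpTo d f {suc m} {zero}  _         = refl
lookupOr-applyUpTo d f {suc m} {suc i} (s≤s i<m) = lookupOr-applyUpTo d (λ j → f (suc j)) i<m

lists≤ : ℕ → List X → List (List X)
lists≤ zero    xs = [] ∷ []
lists≤ (suc m) xs = [] ∷ cartesianProductWith _∷_ xs (lists≤ m xs)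

∈-lists≤ : ∀ m (xs : List X) {ys} → length ys ≤ m → All (_∈ xs) ys → ys ∈ lists≤ m xs
∈-lists≤ zero    xs {[]}     _         _        = here refl
∈-lists≤ (suc m) xs {[]}     _         _        = here refl
∈-lists≤ (suc m) xs {y ∷ ys} (s≤s ≤m) (y∈ ∷ ys∈) =
  there (∈-cartesianProductWith⁺ _∷_ y∈ (∈-lists≤ m xs ≤m ys∈))

length-lists≤ : ∀ m (xs : List X) → length (lists≤ m xs) ≤ suc (length xs) ^ m
length-lists≤ zero    xs = ≤-refl
length-lists≤ (suc m) xs = begin
  suc (length (cartesianProductWith _∷_ xs (lists≤ m xs)))
    ≡⟨ cong suc (length-cartesianProductWith _∷_ xs (lists≤ m xs)) ⟩
  suc (length xs * length (lists≤ m xs))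
    ≤⟨ s≤s (*-monoʳ-≤ (length xs) (length-lists≤ m xs)) ⟩
  suc (length xs * suc (length xs) ^ m)
    ≤⟨ +-monoˡ-≤ _ (m^n>0 (suc (length xs)) m) ⟩
  suc (length xs) ^ m + length xs * suc (length xs) ^ m ∎
  where open ≤-Reasoning

∈-─⁺ : ∀ {x y} {xs : List X} (x∈ : x ∈ xs) → y ∈ xs → y ≢ x → y ∈ (xs ─ x∈)
∈-─⁺ (here refl) (here refl) y≢x = contradiction refl y≢x
∈-─⁺ (here refl) (there y∈)  _   = y∈
∈-─⁺ (there x∈)  (here refl) _   = here refl
∈-─⁺ (there x∈)  (there y∈)  y≢x = there (∈-─⁺ x∈ y∈ y≢x)

Unique-⊆⇒length≤ : ∀ {xs ys : List X} → Unique xs → xs ⊆ ys → length xs ≤ length ys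
Unique-⊆⇒length≤ {xs = []}     _              _  = z≤n
Unique-⊆⇒length≤ {xs = x ∷ xs} {ys} (x∉ ∷ !xs) xs⊆ = begin
  suc (length xs)        ≤⟨ s≤s (Unique-⊆⇒length≤ !xs xs⊆ys─x) ⟩
  suc (length (ys ─ x∈)) ≡⟨ length-removeAt′ ys _ ⟨
  length ys              ∎
  where
  open ≤-Reasoning
  x∈ : x ∈ ys
  x∈ = xs⊆ (here refl)
  xs⊆ys─x : xs ⊆ (ys ─ x∈)
  xs⊆ys─x y∈ = ∈-─⁺ x∈ (xs⊆ (there y∈)) (≢-sym (All.lookup x∉ y∈))

matrix : ℕ → (ℕ → ℕ → X) → List (List X)
matrix m f = applyUpTo (λ i → applyUpTo (f i) m) m

entry : X → List (List X) → ℕ → ℕ → X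
entry d rows i j = lookupOr d (lookupOr [] rows i) j

entry-matrix : ∀ d {m} (f : ℕ → ℕ → X) {i j} → i < m → j < m → entry d (matrix m f) i j ≡ f i j
entry-matrix d {m} f {i} {j} i<m j<m =
  trans (cong (λ row → lookupOr d row j) (lookupOr-applyUpTo [] (λ i → applyUpTo (f i) m) i<m))
        (lookupOr-applyUpTo d (f i) j<m)

matrix∈lists≤ : ∀ m (xs : List X) (f : ℕ → ℕ → X) → (∀ i j → f i j ∈ xs) →
                matrix m f ∈ lists≤ m (lists≤ m xs)
matrix∈lists≤ m xs f f∈ = tabulated∈ _ (λ i → tabulated∈ (f i) (f∈ i))
  where
  tabulated∈ : ∀ {xs : List Y} (g : ℕ → Y) → (∀ i → g i ∈ xs) → applyUpTo g m ∈ lists≤ m xs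
  tabulated∈ g g∈ = ∈-lists≤ m _ (≤-reflexive (length-applyUpTo g m)) (All.applyUpTo⁺₂ g m g∈)

map-Unique : ∀ {Q : X → Set} {R : X → X → Set} (f : X → Y) →
  (∀ {x y} → Q x → Q y → f x ≡ f y → R x y) →
  ∀ {xs} → All Q xs → AllPairs (λ x y → ¬ R x y) xs → Unique (map f xs)
map-Unique f inj []         []          = []
map-Unique f inj (qx ∷ qxs) (x∉ ∷ !xs) =
  All.map⁺ (All.zipWith (λ (qy , ¬Rxy) → ¬Rxy ∘ inj qx qy) (qxs , x∉)) ∷ map-Unique f inj qxs !xs

length≤+sum-drop : ∀ m xs → All (0 <_) xs → length xs ≤ m + sum (drop m xs)
length≤+sum-drop zero    []       _          = z≤n
length≤+sum-drop zero    (x ∷ xs) (0<x ∷ ps) = +-mono-≤ 0<x (length≤+sum-drop zero xs ps)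
length≤+sum-drop (suc m) []       _          = z≤n
length≤+sum-drop (suc m) (x ∷ xs) (_ ∷ ps)   = s≤s (length≤+sum-drop m xs ps)

^-distribʳ-* : ∀ m n k → (m * n) ^ k ≡ m ^ k * n ^ k
^-distribʳ-* m n zero    = refl
^-distribʳ-* m n (suc k) = begin
  m * n * (m * n) ^ k     ≡⟨ cong (m * n *_) (^-distribʳ-* m n k) ⟩
  m * n * (m ^ k * n ^ k) ≡⟨ solve 4 (λ m n x y → m :* n :* (x :* y) := m :* x :* (n :* y))
                                     refl m n (m ^ k) (n ^ k) ⟩
  m * m ^ k * (n * n ^ k) ∎
  where open ≡-Reasoning
        open +-*-Solver

partOf : List ℕ → ℕ → ℕ
partOf []      x = 0
partOf (v ∷ c) x with x <? v
... | yes _ = 0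
... | no  _ = suc (partOf c (x ∸ v))

InRange : ℕ → ℕ → ℕ → Set
InRange a b x = a ≤ x × x < b

InRange-distinct⇒1+< : ∀ {p q x y} → InRange p q x → InRange p q y → x ≢ y → suc p < q
InRange-distinct⇒1+< {p} {x = x} (p≤x , x<q) (p≤y , y<q) x≢y with x ≟ p
... | yes refl = <-≤-trans (s≤s (≤∧≢⇒< p≤y x≢y)) y<q
... | no  x≢p  = <-≤-trans (s≤s (≤∧≢⇒< p≤x (≢-sym x≢p))) x<q

InPart : List ℕ → ℕ → ℕ → Set
InPart c i = InRange (sum (take i c)) (sum (take (suc i) c))

∸-<-+ : ∀ {x} m {n} → m ≤ x → x < m + n → x ∸ m < n
∸-<-+ m {n} m≤x x< = subst (_ <_) (m+n∸m≡n m n) (∸-monoˡ-< x< m≤x)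

partOf<length : ∀ c {x} → x < sum c → partOf c x < length c
partOf<length (v ∷ c) {x} x<Σ with x <? v
... | yes _   = s≤s z≤n
... | no  x≮v = s≤s (partOf<length c (∸-<-+ v (≮⇒≥ x≮v) x<Σ))

partOf-bounds : ∀ c {x} → x < sum c → InPart c (partOf c x) x
partOf-bounds (v ∷ c) {x} x<Σ with x <? v
... | yes x<v = z≤n , subst (x <_) (≡.sym (+-identityʳ v)) x<v
... | no  x≮v = lower , upper
  where
  v≤x = ≮⇒≥ x≮v
  i = partOf c (x ∸ v)
  bounds = partOf-bounds c (∸-<-+ v v≤x x<Σ)
  lower : v + sum (take i c) ≤ x
  lower = subst (v + sum (take i c) ≤_) (m+[n∸m]≡n v≤x) (+-monoʳ-≤ v (proj₁ bounds))
  upper : x < v + sum (take (suc i) c)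
  upper = subst (_< v + sum (take (suc i) c)) (m+[n∸m]≡n v≤x) (+-monoʳ-< v (proj₂ bounds))

partOf-unique : ∀ c {i x} → InPart c i x → partOf c x ≡ i
partOf-unique [] (_ , ())
partOf-unique (v ∷ c) {zero} {x} (_ , x<v+0) with x <? v
... | yes _   = refl
... | no  x≮v = contradiction (subst (x <_) (+-identityʳ v) x<v+0) x≮v
partOf-unique (v ∷ c) {suc i} {x} (lo , hi) with x <? v
... | yes x<v = contradiction (≤-trans (m≤m+n v _) lo) (<⇒≱ x<v)
... | no  x≮v = cong suc (partOf-unique c (lo′ , ∸-<-+ v (≮⇒≥ x≮v) hi))
  where lo′ = subst (_≤ x ∸ v) (m+n∸m≡n v _) (∸-monoˡ-≤ v lo)

intervalsFrom : ℕ → List ℕ → List (ℕ × ℕ)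
intervalsFrom s []      = []
intervalsFrom s (v ∷ c) = (s , s + v) ∷ intervalsFrom (s + v) c

∈-intervalsFrom : ∀ c s {i} → i < length c →
  (s + sum (take i c) , s + sum (take (suc i) c)) ∈ intervalsFrom s c
∈-intervalsFrom (v ∷ c) s {zero}  _ = here (cong₂ _,_ (+-identityʳ s) (cong (s +_) (+-identityʳ v)))
∈-intervalsFrom (v ∷ c) s {suc i} (s≤s i<) = there (subst (_∈ intervalsFrom (s + v) c)
  (cong₂ _,_ (+-assoc s v _) (+-assoc s v _)) (∈-intervalsFrom c (s + v) i<))

-- A 0 among the small parts marks a part larger than M, so the parts must be positive; the last
-- large part is recovered from the total.
module LargeParts (M : ℕ) where

  #large : List ℕ → ℕ
  #large []      = 0
  #large (v ∷ c) with M <? v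
  ... | yes _ = suc (#large c)
  ... | no  _ = #large c

  smallOrZero : ℕ → ℕ
  smallOrZero v with M <? v
  ... | yes _ = 0
  ... | no  _ = v

  largeButLast : List ℕ → List ℕ
  largeButLast []      = []
  largeButLast (v ∷ c) with M <? v
  ... | no  _ = largeButLast c
  ... | yes _ with #large c
  ...   | zero  = []
  ...   | suc _ = v ∷ largeButLast c

  decode : List ℕ → List ℕ → ℕ → List ℕ
  decode []           ls       r = []
  decode (suc v ∷ ss) ls       r = suc v ∷ decode ss ls (r ∸ suc v)
  decode (zero  ∷ ss) (l ∷ ls) r = l ∷ decode ss ls (r ∸ l)
  decode (zero  ∷ ss) []       r = r ∸ sum ss ∷ decode ss [] 0

  sum-smallOrZero : ∀ c → #large c ≡ 0 → sum (map smallOrZero c) ≡ sum c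
  sum-smallOrZero []      _ = refl
  sum-smallOrZero (v ∷ c) e with M <? v
  ... | yes _ = contradiction e 1+n≢0
  ... | no  _ = cong (v +_) (sum-smallOrZero c e)

  decode-noLarge : ∀ c → All (0 <_) c → #large c ≡ 0 → ∀ r → decode (map smallOrZero c) [] r ≡ c
  decode-noLarge []      _          _ r = refl
  decode-noLarge (v ∷ c) (0<v ∷ ps) e r with M <? v
  ... | yes _ = contradiction e 1+n≢0
  decode-noLarge (suc v ∷ c) (_ ∷ ps) e r | no _ = cong (suc v ∷_) (decode-noLarge c ps e _)

  decode-encode : ∀ c → All (0 <_) c → decode (map smallOrZero c) (largeButLast c) (sum c) ≡ c
  decode-encode []      _          = refl
  decode-encode (v ∷ c) (0<v ∷ ps) with M <? v
  decode-encode (suc v ∷ c) (_ ∷ ps) | no _ =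
    cong (suc v ∷_) (trans (cong (decode _ _) (m+n∸m≡n (suc v) (sum c))) (decode-encode c ps))
  ... | yes _ with #large c in eq
  ...   | zero  = cong₂ _∷_ (trans (cong (v + sum c ∸_) (sum-smallOrZero c eq)) (m+n∸n≡m v (sum c)))
                            (decode-noLarge c ps eq 0)
  ...   | suc _ = cong (v ∷_) (trans (cong (decode _ _) (m+n∸m≡n v (sum c))) (decode-encode c ps))

  length-largeButLast : ∀ c → length (largeButLast c) ≤ #large c ∸ 1
  length-largeButLast []      = z≤n
  length-largeButLast (v ∷ c) with M <? v
  ... | no  _ = length-largeButLast c
  ... | yes _ with #large c in eq
  ...   | zero  = z≤n
  ...   | suc _ = s≤s (subst (λ t → length (largeButLast c) ≤ t ∸ 1) eq (length-largeButLast c))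

  largeButLast-≤ : ∀ {B} c → All (_≤ B) c → All (_≤ B) (largeButLast c)
  largeButLast-≤ []      _          = []
  largeButLast-≤ (v ∷ c) (v≤B ∷ ps) with M <? v
  ... | no  _ = largeButLast-≤ c ps
  ... | yes _ with #large c
  ...   | zero  = []
  ...   | suc _ = v≤B ∷ largeButLast-≤ c ps

  smallOrZero≤M : ∀ v → smallOrZero v ≤ M
  smallOrZero≤M v with M <? v
  ... | yes _   = z≤n
  ... | no  M≮v = ≮⇒≥ M≮v

  #large-↭ : ∀ {c d} → c ↭ d → #large c ≡ #large d
  #large-↭ {c} {d} c↭d = trans (#large≡sum c) (trans (sum-↭ (map⁺ _ c↭d)) (≡.sym (#large≡sum d)))
    where
    #large-∷ : ∀ v c → #large (v ∷ c) ≡ #large (v ∷ []) + #large c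
    #large-∷ v c with M <? v
    ... | yes _ = refl
    ... | no  _ = refl
    #large≡sum : ∀ c → #large c ≡ sum (map (λ v → #large (v ∷ [])) c)
    #large≡sum []      = refl
    #large≡sum (v ∷ c) = trans (#large-∷ v c) (cong (#large (v ∷ []) +_) (#large≡sum c))

  #large≤ : ∀ m c → sum (drop m c) ≤ M → #large c ≤ m
  #large≤ zero    []      _ = z≤n
  #large≤ zero    (v ∷ c) Σ≤M with M <? v
  ... | yes M<v = contradiction (≤-trans (m≤m+n v _) Σ≤M) (<⇒≱ M<v)
  ... | no  _   = #large≤ zero c (≤-trans (m≤n+m _ v) Σ≤M)
  #large≤ (suc m) []      _ = z≤n
  #large≤ (suc m) (v ∷ c) Σ≤M with M <? v
  ... | yes _ = s≤s (#large≤ m c Σ≤M)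
  ... | no  _ = ≤-trans (#large≤ m c Σ≤M) (n≤1+n m)

module BlockStructure {n : ℕ} (G : Graph n) where

  adjℕ : ℕ → ℕ → Bool
  adjℕ x y with x <? n | y <? n
  ... | yes x<n | yes y<n = adj G (fromℕ< x<n) (fromℕ< y<n)
  ... | _       | _       = false

  adjℕ-< : ∀ {x y} (x<n : x < n) (y<n : y < n) → adjℕ x y ≡ adj G (fromℕ< x<n) (fromℕ< y<n)
  adjℕ-< {x} {y} x<n y<n with x <? n | y <? n
  ... | yes _   | yes _   = refl
  ... | no  x≮n | _       = contradiction x<n x≮n
  ... | yes _   | no  y≮n = contradiction y<n y≮n

  adjℕ-toℕ : ∀ i j → adjℕ (toℕ i) (toℕ j) ≡ adj G i j
  adjℕ-toℕ i j = trans (adjℕ-< (toℕ<n i) (toℕ<n j))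
    (cong₂ (adj G) (fromℕ<-toℕ i (toℕ<n i)) (fromℕ<-toℕ j (toℕ<n j)))

  adjℕ-sym : ∀ {x y} → x < n → y < n → adjℕ x y ≡ adjℕ y x
  adjℕ-sym x<n y<n = trans (adjℕ-< x<n y<n) (trans (Graph.sym G _ _) (≡.sym (adjℕ-< y<n x<n)))

  Twinℕ : ℕ → ℕ → Set
  Twinℕ x y = ∀ {z} → z < n → z ≢ x → z ≢ y → adjℕ x z ≡ adjℕ y z

  twinℕ? : ∀ x y → Dec (Twinℕ x y)
  twinℕ? x y = allUpTo? (λ z → ¬? (z ≟ x) →-dec ¬? (z ≟ y) →-dec (adjℕ x z ≟ᴮ adjℕ y z)) n

  Twinℕ-refl : ∀ x → Twinℕ x x
  Twinℕ-refl x _ _ _ = refl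

  Twinℕ-sym : ∀ {x y} → Twinℕ x y → Twinℕ y x
  Twinℕ-sym t z<n z≢y z≢x = ≡.sym (t z<n z≢x z≢y)

  -- At w = y, the edges xy and zy are compared through the edge xz.
  Twinℕ-trans : ∀ {x y z} → x < n → z < n → Twinℕ x y → Twinℕ y z → Twinℕ x z
  Twinℕ-trans {x} {y} {z} x<n z<n t u {w} w<n w≢x w≢z with x ≟ z | w ≟ y
  ... | yes refl | _        = refl
  ... | no  _    | no  w≢y  = trans (t w<n w≢x w≢y) (u w<n w≢y w≢z)
  ... | no  x≢z  | yes refl = begin
    adjℕ x w ≡⟨ adjℕ-sym x<n w<n ⟩
    adjℕ w x ≡⟨ u x<n (≢-sym w≢x) x≢z ⟩
    adjℕ z x ≡⟨ adjℕ-sym z<n x<n ⟩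
    adjℕ x z ≡⟨ t z<n (≢-sym x≢z) (≢-sym w≢z) ⟩
    adjℕ w z ≡⟨ adjℕ-sym w<n z<n ⟩
    adjℕ z w ∎
    where open ≡-Reasoning

  Twins⇒Twinℕ : ∀ i j → Twins G i j → Twinℕ (toℕ i) (toℕ j)
  Twins⇒Twinℕ i j t {z} z<n z≢i z≢j = begin
    adjℕ (toℕ i) z         ≡⟨ adjℕ-w i ⟨
    adj G i w              ≡⟨ ⇔→≡ (mk⇔ (λ e → proj₁ (Equivalence.to (t w) (e , w≢ j z≢j)))
                                     (λ e → proj₁ (Equivalence.from (t w) (e , w≢ i z≢i)))) ⟩
    adj G j w              ≡⟨ adjℕ-w j ⟩
    adjℕ (toℕ j) z         ∎
    where
    open ≡-Reasoning
    w = fromℕ< z<n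
    adjℕ-w : ∀ k → adj G k w ≡ adjℕ (toℕ k) z
    adjℕ-w k = subst (λ t → adj G k w ≡ adjℕ (toℕ k) t) (toℕ-fromℕ< z<n)
                     (≡.sym (adjℕ-toℕ k w))
    w≢ : ∀ k → z ≢ toℕ k → w ≢ k
    w≢ k z≢k w≡k = z≢k (trans (≡.sym (toℕ-fromℕ< z<n)) (cong toℕ w≡k))

  Twinℕ⇒Twins : ∀ i j → Twinℕ (toℕ i) (toℕ j) → Twins G i j
  Twinℕ⇒Twins i j t w = mk⇔ (transfer i j t) (transfer j i (Twinℕ-sym t))
    where
    transfer : ∀ i j → Twinℕ (toℕ i) (toℕ j) → Edge G i w × w ≢ j → Edge G j w × w ≢ i
    transfer i j t (iw , w≢j) = trans (≡.sym same) iw , w≢i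
      where
      w≢i : w ≢ i
      w≢i refl = not-¬ (irrefl G w) iw
      same : adj G i w ≡ adj G j w
      same = trans (≡.sym (adjℕ-toℕ i w))
        (trans (t (toℕ<n w) (w≢i ∘ toℕ-injective) (w≢j ∘ toℕ-injective)) (adjℕ-toℕ j w))

  HomogeneousOn : ℕ → ℕ → Set
  HomogeneousOn a b = ∀ {x y} → InRange a b x → InRange a b y → Twinℕ x y

  Homogeneous⇒HomogeneousOn : ∀ {a b} → b ≤ n → Homogeneous G (a , b) → HomogeneousOn a b
  Homogeneous⇒HomogeneousOn {a} {b} b≤n h x∈@(_ , x<b) y∈@(_ , y<b) =
    subst₂ Twinℕ (toℕ-fromℕ< x<n) (toℕ-fromℕ< y<n)
      (Twins⇒Twinℕ _ _ (h _ _ (inInterval x<n x∈) (inInterval y<n y∈)))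
    where
    x<n = <-≤-trans x<b b≤n
    y<n = <-≤-trans y<b b≤n
    inInterval : ∀ {z} (z<n : z < n) → InRange a b z → InInterval (a , b) (fromℕ< z<n)
    inInterval z<n = subst (InRange a b) (≡.sym (toℕ-fromℕ< z<n))

  HomogeneousOn⇒Homogeneous : ∀ {a b} → HomogeneousOn a b → Homogeneous G (a , b)
  HomogeneousOn⇒Homogeneous h x y x∈ y∈ = Twinℕ⇒Twins x y (h x∈ y∈)

  Joined : ℕ → Set
  Joined i = Twinℕ (pred i) i

  JoinedIn : ℕ → ℕ → Set
  JoinedIn a b = ∀ {j} → a < j → j < b → Joined j

  HomogeneousOn⇒JoinedIn : ∀ {a b} → HomogeneousOn a b → JoinedIn a b
  HomogeneousOn⇒JoinedIn h {suc j} a<1+j 1+j<b =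
    h (s≤s⁻¹ a<1+j , <-trans (n<1+n j) 1+j<b) (<⇒≤ a<1+j , 1+j<b)

  JoinedIn⇒Twinℕ : ∀ {a b} → b ≤ n → JoinedIn a b →
                   ∀ {x y} → a ≤ x → x ≤ y → y < b → Twinℕ x y
  JoinedIn⇒Twinℕ b≤n J {x} {zero}  _   x≤0   _     rewrite n≤0⇒n≡0 x≤0 = Twinℕ-refl 0
  JoinedIn⇒Twinℕ b≤n J {x} {suc y} a≤x x≤1+y 1+y<b with m≤n⇒m<n∨m≡n x≤1+y
  ... | inj₂ refl    = Twinℕ-refl x
  ... | inj₁ x<1+y = Twinℕ-trans (<-≤-trans (≤-<-trans x≤y y<b) b≤n) (<-≤-trans 1+y<b b≤n)
                       (JoinedIn⇒Twinℕ b≤n J a≤x x≤y y<b) (J (s≤s (≤-trans a≤x x≤y)) 1+y<b)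
    where
    x≤y = s≤s⁻¹ x<1+y
    y<b = <-trans (n<1+n y) 1+y<b

  JoinedIn⇒HomogeneousOn : ∀ {a b} → b ≤ n → JoinedIn a b → HomogeneousOn a b
  JoinedIn⇒HomogeneousOn b≤n J {x} {y} (a≤x , x<b) (a≤y , y<b) with ≤-total x y
  ... | inj₁ x≤y = JoinedIn⇒Twinℕ b≤n J a≤x x≤y y<b
  ... | inj₂ y≤x = Twinℕ-sym (JoinedIn⇒Twinℕ b≤n J a≤y y≤x x<b)

  JoinedIn-extendʳ : ∀ {a b} → JoinedIn a b → Joined b → JoinedIn a (suc b)
  JoinedIn-extendʳ J Jb a<j j<1+b with m≤n⇒m<n∨m≡n (s≤s⁻¹ j<1+b)
  ... | inj₁ j<b  = J a<j j<b
  ... | inj₂ refl = Jb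

  JoinedIn-extendˡ : ∀ {a b} → JoinedIn (suc a) b → Joined (suc a) → JoinedIn a b
  JoinedIn-extendˡ J Ja a<j j<b with m≤n⇒m<n∨m≡n a<j
  ... | inj₁ 1+a<j = J 1+a<j j<b
  ... | inj₂ refl  = Ja

  record Block (a b : ℕ) : Set where
    field
      a<b       : a < b
      b≤n       : b ≤ n
      left-end  : a ≡ 0 ⊎ ¬ Joined a
      right-end : b ≡ n ⊎ ¬ Joined b
      joined    : JoinedIn a b

  Block-homogeneous : ∀ {a b} → Block a b → HomogeneousOn a b
  Block-homogeneous B = JoinedIn⇒HomogeneousOn (Block.b≤n B) (Block.joined B)

  JoinedIn⇒Homogeneous : ∀ {a b} → b ≤ n → JoinedIn a b → Homogeneous G (a , b)
  JoinedIn⇒Homogeneous b≤n J = HomogeneousOn⇒Homogeneous (JoinedIn⇒HomogeneousOn b≤n J)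

  Homogeneous⇒JoinedIn : ∀ {a b} → b ≤ n → Homogeneous G (a , b) → JoinedIn a b
  Homogeneous⇒JoinedIn b≤n H = HomogeneousOn⇒JoinedIn (Homogeneous⇒HomogeneousOn b≤n H)

  Maximal : ℕ → ℕ → Set
  Maximal a b = ∀ a' b' → a' ≤ a → b ≤ b' → b' ≤ n → Homogeneous G (a' , b') → a' ≡ a × b' ≡ b

  Block⇒Maximal : ∀ {a b} → Block a b → Maximal a b
  Block⇒Maximal {a} {b} B a' b' a'≤a b≤b' b'≤n H = ≤∧≮⇒≡ a'≤a a'≮a , ≡.sym (≤∧≮⇒≡ b≤b' b≮b')
    where
    open Block B
    J = Homogeneous⇒JoinedIn b'≤n H
    a'≮a : ¬ a' < a
    a'≮a a'<a with left-end
    ... | inj₁ refl = n≮0 a'<a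
    ... | inj₂ ¬Ja  = ¬Ja (J a'<a (<-≤-trans a<b b≤b'))
    b≮b' : ¬ b < b'
    b≮b' b<b' with right-end
    ... | inj₁ refl = <⇒≱ b<b' b'≤n
    ... | inj₂ ¬Jb  = ¬Jb (J (≤-<-trans a'≤a a<b) b<b')

  Maximal⇒left-end : ∀ {a b} → b ≤ n → JoinedIn a b → Maximal a b → a ≡ 0 ⊎ ¬ Joined a
  Maximal⇒left-end {zero}      _   _ _       = inj₁ refl
  Maximal⇒left-end {suc a} {b} b≤n J maximal = inj₂ λ Ja →
    1+n≢n (≡.sym (proj₁ (maximal a b (n≤1+n a) ≤-refl b≤n
                           (JoinedIn⇒Homogeneous b≤n (JoinedIn-extendˡ J Ja)))))

  Maximal⇒right-end : ∀ {a b} → b ≤ n → JoinedIn a b → Maximal a b → b ≡ n ⊎ ¬ Joined b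
  Maximal⇒right-end {a} {b} b≤n J maximal with b ≟ n
  ... | yes b≡n = inj₁ b≡n
  ... | no  b≢n = inj₂ λ Jb →
    1+n≢n (proj₂ (maximal a (suc b) ≤-refl (n≤1+n b) b<n
                   (JoinedIn⇒Homogeneous b<n (JoinedIn-extendʳ J Jb))))
    where b<n = ≤∧≢⇒< b≤n b≢n

  Block⇒IsHomBlock : ∀ {a b} → Block a b → IsHomBlock G (a , b)
  Block⇒IsHomBlock B = a<b , b≤n , JoinedIn⇒Homogeneous b≤n joined , Block⇒Maximal B
    where open Block B

  IsHomBlock⇒Block : ∀ {a b} → IsHomBlock G (a , b) → Block a b
  IsHomBlock⇒Block (a<b , b≤n , H , maximal) = record
    { a<b = a<b ; b≤n = b≤n ; left-end = Maximal⇒left-end b≤n J maximal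
    ; right-end = Maximal⇒right-end b≤n J maximal ; joined = J }
    where J = Homogeneous⇒JoinedIn b≤n H

  record BlockPrefix (s i : ℕ) : Set where
    field
      s<i      : s < i
      left-end : s ≡ 0 ⊎ ¬ Joined s
      joined   : JoinedIn s i

  BlockPrefix-extend : ∀ {s i} → BlockPrefix s i → Joined i → BlockPrefix s (suc i)
  BlockPrefix-extend P Ji = record
    { s<i = m<n⇒m<1+n s<i ; left-end = left-end ; joined = JoinedIn-extendʳ joined Ji }
    where open BlockPrefix P

  BlockPrefix-start : ∀ {i} → ¬ Joined i → BlockPrefix i (suc i)
  BlockPrefix-start ¬Ji = record
    { s<i = n<1+n _ ; left-end = inj₂ ¬Ji
    ; joined = λ i<j j<1+i → contradiction (s≤s⁻¹ j<1+i) (<⇒≱ i<j) }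

  BlockPrefix-no-start : ∀ {s i a} → BlockPrefix s i → s < a → a < i → ¬ (a ≡ 0 ⊎ ¬ Joined a)
  BlockPrefix-no-start _ s<a _   (inj₁ refl) = n≮0 s<a
  BlockPrefix-no-start P s<a a<i (inj₂ ¬Ja) = ¬Ja (BlockPrefix.joined P s<a a<i)

  -- The scan over i, …, i + f − 1 with the current block starting at s; i opens a new block
  -- exactly when i − 1 and i are not twins.
  blocksFrom : ℕ → ℕ → ℕ → List (ℕ × ℕ)
  blocksFrom s i zero    = (s , i) ∷ []
  blocksFrom s i (suc f) with twinℕ? (pred i) i
  ... | yes _ = blocksFrom s (suc i) f
  ... | no  _ = (s , i) ∷ blocksFrom i (suc i) f

  ∈-blocksFrom⇒Block : ∀ f {s i a b} → f + i ≡ n → BlockPrefix s i →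
                       (a , b) ∈ blocksFrom s i f → s ≤ a × Block a b
  ∈-blocksFrom⇒Block zero refl P (here refl) = ≤-refl , record
    { a<b = s<i ; b≤n = ≤-refl ; left-end = left-end ; right-end = inj₁ refl ; joined = joined }
    where open BlockPrefix P
  ∈-blocksFrom⇒Block (suc f) {s} {i} f+i≡n P ∈bs with twinℕ? (pred i) i
  ... | yes Ji = ∈-blocksFrom⇒Block f (trans (+-suc f i) f+i≡n) (BlockPrefix-extend P Ji) ∈bs
  ... | no ¬Ji with ∈bs
  ...   | here refl = ≤-refl , record
          { a<b = s<i ; b≤n = subst (i ≤_) f+i≡n (m≤n+m i (suc f))
          ; left-end = left-end ; right-end = inj₂ ¬Ji ; joined = joined }
    where open BlockPrefix P
  ...   | there ∈bs′ =
          let i≤a , B = ∈-blocksFrom⇒Block f (trans (+-suc f i) f+i≡n) (BlockPrefix-start ¬Ji) ∈bs′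
          in ≤-trans (<⇒≤ (BlockPrefix.s<i P)) i≤a , B

  Block-starts-prefix : ∀ {s i a b} → BlockPrefix s i → Block a b → s ≤ a → a < i → a ≡ s
  Block-starts-prefix P B s≤a a<i with m≤n⇒m<n∨m≡n s≤a
  ... | inj₁ s<a  = contradiction (Block.left-end B) (BlockPrefix-no-start P s<a a<i)
  ... | inj₂ refl = refl

  Block-covers-prefix : ∀ {s i b} → i ≤ n → BlockPrefix s i → Block s b → ¬ b < i
  Block-covers-prefix i≤n P B b<i with Block.right-end B
  ... | inj₁ refl = <⇒≱ b<i i≤n
  ... | inj₂ ¬Jb  = ¬Jb (BlockPrefix.joined P (Block.a<b B) b<i)

  Block⇒∈-blocksFrom : ∀ f {s i a b} → f + i ≡ n → BlockPrefix s i → s ≤ a → Block a b →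
                       (a , b) ∈ blocksFrom s i f
  Block⇒∈-blocksFrom zero {s} refl P s≤a B with Block-starts-prefix P B s≤a (<-≤-trans (Block.a<b B) (Block.b≤n B))
  ... | refl = here (cong (s ,_) (≤∧≮⇒≡ (Block.b≤n B) (Block-covers-prefix ≤-refl P B)))
  Block⇒∈-blocksFrom (suc f) {s} {i} {a} {b} f+i≡n P s≤a B with twinℕ? (pred i) i
  ... | yes Ji = Block⇒∈-blocksFrom f (trans (+-suc f i) f+i≡n) (BlockPrefix-extend P Ji) s≤a B
  ... | no ¬Ji with a <? i
  ...   | no  a≮i =
    there (Block⇒∈-blocksFrom f (trans (+-suc f i) f+i≡n) (BlockPrefix-start ¬Ji) (≮⇒≥ a≮i) B)
  ...   | yes a<i with Block-starts-prefix P B s≤a a<i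
  ...     | refl = here (cong (s ,_) (≤∧≮⇒≡ b≤i (Block-covers-prefix i≤n P B)))
    where
    i≤n = subst (i ≤_) f+i≡n (m≤n+m i (suc f))
    b≤i = ≮⇒≥ λ i<b → ¬Ji (Block.joined B a<i i<b)

  blocksFrom-Unique : ∀ f {s i} → f + i ≡ n → BlockPrefix s i → Unique (blocksFrom s i f)
  blocksFrom-Unique zero    _ _ = [] ∷ []
  blocksFrom-Unique (suc f) {s} {i} f+i≡n P with twinℕ? (pred i) i
  ... | yes Ji = blocksFrom-Unique f (trans (+-suc f i) f+i≡n) (BlockPrefix-extend P Ji)
  ... | no ¬Ji = All.tabulate (λ ∈bs s,i≡I → <⇒≱ (BlockPrefix.s<i P) (later ∈bs s,i≡I))
               ∷ blocksFrom-Unique f f+1+i≡n (BlockPrefix-start ¬Ji)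
    where
    f+1+i≡n = trans (+-suc f i) f+i≡n
    later : ∀ {I} → I ∈ blocksFrom i (suc i) f → (s , i) ≡ I → i ≤ s
    later ∈bs refl = proj₁ (∈-blocksFrom⇒Block f f+1+i≡n (BlockPrefix-start ¬Ji) ∈bs)

  intervalsFrom-blocksFrom : ∀ f {s i} → s ≤ i →
                             intervalsFrom s (map size (blocksFrom s i f)) ≡ blocksFrom s i f
  intervalsFrom-blocksFrom zero    s≤i = cong (λ t → (_ , t) ∷ []) (m+[n∸m]≡n s≤i)
  intervalsFrom-blocksFrom (suc f) {s} {i} s≤i with twinℕ? (pred i) i
  ... | yes _ = intervalsFrom-blocksFrom f (m≤n⇒m≤1+n s≤i)
  ... | no  _ rewrite m+[n∸m]≡n s≤i = cong ((s , i) ∷_) (intervalsFrom-blocksFrom f (n≤1+n i))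

  sum-size-blocksFrom : ∀ f {s i} → s ≤ i → s + sum (map size (blocksFrom s i f)) ≡ f + i
  sum-size-blocksFrom zero {s} {i} s≤i = trans (cong (s +_) (+-identityʳ (i ∸ s))) (m+[n∸m]≡n s≤i)
  sum-size-blocksFrom (suc f) {s} {i} s≤i with twinℕ? (pred i) i
  ... | yes _ = trans (sum-size-blocksFrom f (m≤n⇒m≤1+n s≤i)) (+-suc f i)
  ... | no  _ = begin
    s + (i ∸ s + rest) ≡⟨ +-assoc s (i ∸ s) rest ⟨
    s + (i ∸ s) + rest ≡⟨ cong (_+ rest) (m+[n∸m]≡n s≤i) ⟩
    i + rest           ≡⟨ sum-size-blocksFrom f (n≤1+n i) ⟩
    f + suc i          ≡⟨ +-suc f i ⟩
    suc f + i          ∎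
    where
    open ≡-Reasoning
    rest = sum (map size (blocksFrom i (suc i) f))

  HomogeneousOn-adjℕ : ∀ {p q} → q ≤ n → HomogeneousOn p q → ∀ {u v a b} →
    InRange p q u → InRange p q v → InRange p q a → InRange p q b →
    u ≢ v → a ≢ b → adjℕ u v ≡ adjℕ a b
  HomogeneousOn-adjℕ {p} {q} q≤n h {u} {v} {a} {b} u∈ v∈ a∈ b∈ u≢v a≢b =
    go (b ≟ u) (v ≟ b) (v ≟ a)
    where
    <n : ∀ {x} → InRange p q x → x < n
    <n (_ , x<q) = <-≤-trans x<q q≤n
    open ≡-Reasoning
    go : Dec (b ≡ u) → Dec (v ≡ b) → Dec (v ≡ a) → adjℕ u v ≡ adjℕ a b
    go (no b≢u) (yes refl) _ = h u∈ a∈ (<n b∈) b≢u (≢-sym a≢b)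
    go (no b≢u) (no v≢b)   _ = begin
      adjℕ u v ≡⟨ adjℕ-sym (<n u∈) (<n v∈) ⟩
      adjℕ v u ≡⟨ h v∈ b∈ (<n u∈) u≢v (≢-sym b≢u) ⟩
      adjℕ b u ≡⟨ adjℕ-sym (<n b∈) (<n u∈) ⟩
      adjℕ u b ≡⟨ h u∈ a∈ (<n b∈) b≢u (≢-sym a≢b) ⟩
      adjℕ a b ∎
    go (yes refl) _ (yes refl) = adjℕ-sym (<n u∈) (<n v∈)
    go (yes refl) _ (no v≢a)   = begin
      adjℕ u v ≡⟨ adjℕ-sym (<n u∈) (<n v∈) ⟩
      adjℕ v u ≡⟨ h v∈ a∈ (<n u∈) u≢v (≢-sym a≢b) ⟩
      adjℕ a u ∎

  module Decomposition (1≤n : 1 ≤ n) where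

    blocks : List (ℕ × ℕ)
    blocks = blocksFrom 0 1 (n ∸ 1)

    private
      n∸1+1≡n : n ∸ 1 + 1 ≡ n
      n∸1+1≡n = m∸n+n≡m 1≤n

      prefix₀ : BlockPrefix 0 1
      prefix₀ = record { s<i = s≤s z≤n ; left-end = inj₁ refl
                       ; joined = λ 0<j j<1 → contradiction (s≤s⁻¹ j<1) (<⇒≱ 0<j) }

    ∈blocks⇒Block : ∀ {a b} → (a , b) ∈ blocks → Block a b
    ∈blocks⇒Block ∈bs = proj₂ (∈-blocksFrom⇒Block (n ∸ 1) n∸1+1≡n prefix₀ ∈bs)

    ∈blocks⇔IsHomBlock : ∀ I → I ∈ blocks ⇔ IsHomBlock G I
    ∈blocks⇔IsHomBlock I = mk⇔ (Block⇒IsHomBlock ∘ ∈blocks⇒Block)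
                                (Block⇒∈-blocksFrom (n ∸ 1) n∸1+1≡n prefix₀ z≤n ∘ IsHomBlock⇒Block)

    sizes : List ℕ
    sizes = map size blocks

    isHomBlockSeq : IsHomBlockSeq G (sort sizes)
    isHomBlockSeq = blocks , blocksFrom-Unique (n ∸ 1) n∸1+1≡n prefix₀ , ∈blocks⇔IsHomBlock
                  , sort-↭ sizes , sort-↗ sizes

    blocks-Block : All (λ I → Block (proj₁ I) (proj₂ I)) blocks
    blocks-Block = All.tabulate ∈blocks⇒Block

    sizes-positive : All (0 <_) sizes
    sizes-positive = All.map⁺ (All.map (λ B → m<n⇒0<n∸m (Block.a<b B)) blocks-Block)

    sizes-≤n : All (_≤ n) sizes
    sizes-≤n = All.map⁺ (All.map (λ {I} B → ≤-trans (m∸n≤m (proj₂ I) (proj₁ I)) (Block.b≤n B))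
                                 blocks-Block)

    sum-sizes : sum sizes ≡ n
    sum-sizes = trans (sum-size-blocksFrom (n ∸ 1) z≤n) n∸1+1≡n

    intervalsFrom-sizes : intervalsFrom 0 sizes ≡ blocks
    intervalsFrom-sizes = intervalsFrom-blocksFrom (n ∸ 1) z≤n

    start : ℕ → ℕ
    start i = sum (take i sizes)

    blockOf : ℕ → ℕ
    blockOf = partOf sizes

    BlockAt : ℕ → Set
    BlockAt i = Block (start i) (start (suc i))

    blockOf-BlockAt : ∀ {x} → x < n → BlockAt (blockOf x)
    blockOf-BlockAt {x} x<n =
      All.lookup blocks-Block (subst ((start i , start (suc i)) ∈_) intervalsFrom-sizes
                                      (∈-intervalsFrom sizes 0 (partOf<length sizes x<Σ)))
      where
      i = blockOf x
      x<Σ = subst (x <_) (≡.sym sum-sizes) x<n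

    InBlock-blockOf : ∀ {x} → x < n → InPart sizes (blockOf x) x
    InBlock-blockOf {x} x<n = partOf-bounds sizes (subst (x <_) (≡.sym sum-sizes) x<n)

    blockOf-start : ∀ {i} → BlockAt i → blockOf (start i) ≡ i
    blockOf-start B = partOf-unique sizes (≤-refl , Block.a<b B)

    -- On the diagonal: whether the block is a clique, read off its first two vertices.
    blockAdj : ℕ → ℕ → Bool
    blockAdj i j with i ≟ j
    ... | yes _ = adjℕ (start i) (suc (start i))
    ... | no  _ = adjℕ (start i) (start j)

    adjℕ-blockAdj : ∀ {x y} → x < n → y < n → x ≢ y → adjℕ x y ≡ blockAdj (blockOf x) (blockOf y)
    adjℕ-blockAdj {x} {y} x<n y<n x≢y with blockOf x ≟ blockOf y
    ... | yes i≡j =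
      HomogeneousOn-adjℕ (Block.b≤n B) (Block-homogeneous B) x∈ y∈ p∈ p+1∈ x≢y (≢-sym 1+n≢n)
      where
      B = blockOf-BlockAt x<n
      x∈ = InBlock-blockOf x<n
      y∈ = subst (λ i → InPart sizes i y) (≡.sym i≡j) (InBlock-blockOf y<n)
      p∈ = ≤-refl , Block.a<b B
      p+1∈ = n≤1+n _ , InRange-distinct⇒1+< x∈ y∈ x≢y
    ... | no i≢j = begin
      adjℕ x y  ≡⟨ Block-homogeneous Bx x∈ p∈ y<n (≢-sym x≢y) y≢p ⟩
      adjℕ p y  ≡⟨ adjℕ-sym p<n y<n ⟩
      adjℕ y p  ≡⟨ Block-homogeneous By y∈ p'∈ p<n (≢-sym y≢p) p≢p' ⟩
      adjℕ p' p ≡⟨ adjℕ-sym p'<n p<n ⟩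
      adjℕ p p' ∎
      where
      open ≡-Reasoning
      Bx = blockOf-BlockAt x<n
      By = blockOf-BlockAt y<n
      p = start (blockOf x)
      p' = start (blockOf y)
      x∈ = InBlock-blockOf x<n
      y∈ = InBlock-blockOf y<n
      p∈ = ≤-refl , Block.a<b Bx
      p'∈ = ≤-refl , Block.a<b By
      p<n = <-≤-trans (Block.a<b Bx) (Block.b≤n Bx)
      p'<n = <-≤-trans (Block.a<b By) (Block.b≤n By)
      y≢p : y ≢ p
      y≢p y≡p = i≢j (trans (≡.sym (blockOf-start Bx)) (cong blockOf (≡.sym y≡p)))
      p≢p' : p ≢ p'
      p≢p' p≡p' =
        i≢j (trans (≡.sym (blockOf-start Bx)) (trans (cong blockOf p≡p') (blockOf-start By)))

Code : Set
Code = List ℕ × List ℕ × List (List Bool)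

module Counting (k M : ℕ) where
  open LargeParts M

  R : ℕ
  R = suc k + M

  smallPartLists : List (List ℕ)
  smallPartLists = lists≤ R (upTo (suc M))

  largePartLists : ℕ → List (List ℕ)
  largePartLists n = lists≤ k (upTo (suc n))

  matrices : List (List (List Bool))
  matrices = lists≤ R (lists≤ R (true ∷ false ∷ []))

  codes : ℕ → List Code
  codes n = cartesianProduct smallPartLists (cartesianProduct (largePartLists n) matrices)

  decodeAdj : ℕ → Code → ℕ → ℕ → Bool
  decodeAdj n (ss , ls , mat) x y with x ≟ y
  ... | yes _ = false
  ... | no  _ = entry false mat (partOf c x) (partOf c y)
    where c = decode ss ls n

  module _ {n} (1≤n : 1 ≤ n) (G : Graph n) where
    open BlockStructure G
    open Decomposition 1≤n

    code : Code
    code = map smallOrZero sizes , largeButLast sizes , matrix R blockAdj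

    Sparse : Set
    Sparse = sum (drop (suc k) (sort sizes)) ≤ M

    module _ (sparse : Sparse) where

      length-sizes≤R : length sizes ≤ R
      length-sizes≤R = begin
        length sizes                            ≡⟨ ↭-length (sort-↭ sizes) ⟨
        length (sort sizes)                     ≤⟨ length≤+sum-drop (suc k) (sort sizes) sorted-positive ⟩
        suc k + sum (drop (suc k) (sort sizes)) ≤⟨ +-monoʳ-≤ (suc k) sparse ⟩
        R                                       ∎
        where
        open ≤-Reasoning
        sorted-positive = All-resp-↭ (↭-sym (sort-↭ sizes)) sizes-positive

      code∈codes : code ∈ codes n
      code∈codes = ∈-cartesianProductWith⁺ _,_ small∈ (∈-cartesianProductWith⁺ _,_ large∈ matrix∈)
        where
        small∈ = ∈-lists≤ R _ (≤-trans (≤-reflexive (length-map smallOrZero sizes)) length-sizes≤R)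
                   (All.map⁺ (All.universal (λ v → ∈-upTo⁺ (s≤s (smallOrZero≤M v))) sizes))
        #large≤1+k = subst (_≤ suc k) (#large-↭ (sort-↭ sizes)) (#large≤ (suc k) (sort sizes) sparse)
        large∈ = ∈-lists≤ k _ (≤-trans (length-largeButLast sizes) (∸-monoˡ-≤ 1 #large≤1+k))
                   (All.map (λ v≤n → ∈-upTo⁺ (s≤s v≤n)) (largeButLast-≤ sizes sizes-≤n))
        bool∈ : ∀ b → b ∈ true ∷ false ∷ []
        bool∈ true  = here refl
        bool∈ false = there (here refl)
        matrix∈ = matrix∈lists≤ R _ blockAdj λ i j → bool∈ (blockAdj i j)

      decodeAdj-code : ∀ a b → decodeAdj n code (toℕ a) (toℕ b) ≡ adj G a b
      decodeAdj-code a b with toℕ a ≟ toℕ b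
      ... | yes a≡b = subst (λ b → false ≡ adj G a b) (toℕ-injective a≡b) (≡.sym (irrefl G a))
      ... | no  a≢b = begin
        entry false (matrix R blockAdj) (partOf c (toℕ a)) (partOf c (toℕ b))
          ≡⟨ cong (λ c → entry false (matrix R blockAdj) (partOf c (toℕ a)) (partOf c (toℕ b)))
                  decode≡sizes ⟩
        entry false (matrix R blockAdj) (blockOf (toℕ a)) (blockOf (toℕ b))
          ≡⟨ entry-matrix false blockAdj (blockOf<R a) (blockOf<R b) ⟩
        blockAdj (blockOf (toℕ a)) (blockOf (toℕ b))
          ≡⟨ adjℕ-blockAdj (toℕ<n a) (toℕ<n b) a≢b ⟨
        adjℕ (toℕ a) (toℕ b)
          ≡⟨ adjℕ-toℕ a b ⟩
        adj G a b ∎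
        where
        open ≡-Reasoning
        c = decode (map smallOrZero sizes) (largeButLast sizes) n
        decode≡sizes : c ≡ sizes
        decode≡sizes = trans (cong (decode _ _) (≡.sym sum-sizes)) (decode-encode sizes sizes-positive)
        blockOf<R : ∀ x → blockOf (toℕ x) < R
        blockOf<R x = <-≤-trans (partOf<length sizes (subst (toℕ x <_) (≡.sym sum-sizes) (toℕ<n x)))
                                length-sizes≤R

  code-injective : ∀ {n} (1≤n : 1 ≤ n) {G H : Graph n} → Sparse 1≤n G → Sparse 1≤n H →
                   code 1≤n G ≡ code 1≤n H → G ≈G H
  code-injective {n} 1≤n {G} {H} sG sH eq a b = begin
    adj G a b                                ≡⟨ decodeAdj-code 1≤n G sG a b ⟨
    decodeAdj n (code 1≤n G) (toℕ a) (toℕ b) ≡⟨ cong (λ c → decodeAdj n c (toℕ a) (toℕ b)) eq ⟩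
    decodeAdj n (code 1≤n H) (toℕ a) (toℕ b) ≡⟨ decodeAdj-code 1≤n H sH a b ⟩
    adj H a b                                ∎
    where open ≡-Reasoning

  C : ℕ
  C = length smallPartLists * (3 ^ k * length matrices)

  length-largePartLists : ∀ {n} → 1 ≤ n → length (largePartLists n) ≤ 3 ^ k * n ^ k
  length-largePartLists {n} 1≤n = begin
    length (largePartLists n)       ≤⟨ length-lists≤ k (upTo (suc n)) ⟩
    suc (length (upTo (suc n))) ^ k ≡⟨ cong (λ m → suc m ^ k) (length-upTo (suc n)) ⟩
    (2 + n) ^ k                     ≤⟨ ^-monoˡ-≤ k 2+n≤3n ⟩
    (3 * n) ^ k                     ≡⟨ ^-distribʳ-* 3 n k ⟩
    3 ^ k * n ^ k                   ∎
    where
    open ≤-Reasoning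
    2+n≤3n = +-mono-≤ 1≤n (+-mono-≤ 1≤n (≤-reflexive (≡.sym (+-identityʳ n))))

  length-codes : ∀ {n} → 1 ≤ n → length (codes n) ≤ C * n ^ k
  length-codes {n} 1≤n = begin
    length (codes n)
      ≡⟨ length-cartesianProductWith _,_ S (cartesianProduct L Mx) ⟩
    length S * length (cartesianProduct L Mx)
      ≡⟨ cong (length S *_) (length-cartesianProductWith _,_ L Mx) ⟩
    length S * (length L * length Mx)
      ≤⟨ *-monoʳ-≤ (length S) (*-monoˡ-≤ (length Mx) (length-largePartLists 1≤n)) ⟩
    length S * (3 ^ k * n ^ k * length Mx)
      ≡⟨ solve 4 (λ s t x m → s :* (t :* x :* m) := s :* (t :* m) :* x)
                 refl (length S) (3 ^ k) (n ^ k) (length Mx) ⟩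
    C * n ^ k ∎
    where
    open ≤-Reasoning
    open +-*-Solver
    S = smallPartLists
    L = largePartLists n
    Mx = matrices

lemma4p1 : (P : Property) → Hereditary P → (k M : ℕ) →
    (∀ n (G : Graph n) → P n G → ∀ ts → IsHomBlockSeq G ts →
    sum (drop (suc k) ts) ≤ M) →
    ∃[ C ] ∃[ N ] (∀ n → N ≤ n → (Gs : List (Graph n)) →
    All (P n) Gs → Distinct Gs → length Gs ≤ C * n ^ k)
lemma4p1 P _ k M hyp = C , 1 , bound
  where
  open Counting k M
  bound : ∀ n → 1 ≤ n → (Gs : List (Graph n)) → All (P n) Gs → Distinct Gs → length Gs ≤ C * n ^ k
  bound n 1≤n Gs PGs distinct = begin
    length Gs                  ≡⟨ length-map (code 1≤n) Gs ⟨
    length (map (code 1≤n) Gs) ≤⟨ Unique-⊆⇒length≤ codes-distinct codes⊇ ⟩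
    length (codes n)           ≤⟨ length-codes 1≤n ⟩
    C * n ^ k                  ∎
    where
    open ≤-Reasoning
    sparse : All (Sparse 1≤n) Gs
    sparse = All.map (λ {G} PG → hyp n G PG _ (BlockStructure.Decomposition.isHomBlockSeq G 1≤n)) PGs
    codes-distinct : Unique (map (code 1≤n) Gs)
    codes-distinct = map-Unique (code 1≤n) (code-injective 1≤n) sparse distinct
    codes⊇ : map (code 1≤n) Gs ⊆ codes n
    codes⊇ = All.lookup (All.map⁺ {P = _∈ codes n} (All.map (λ {G} → code∈codes 1≤n G) sparse))
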